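{- Let $G$ be a connected graph of order $n_1$, and let $H$ be a graph of order $n_2$ and maximum degree $\Delta$. (i) If $\Delta=n_2-1$, then $\dim_s(K_1+H)=\dim_s(H)+1$. (ii) If $H$ has diameter two and either $\Delta\le n_2-2$ or $n_1\ge 2$, then $\dim_s(G\odot H)=(n_1-1)n_2+\dim_s(H)$. (iii) If $H$ is not connected or its diameter is greater than two, then $\dim_s(G\odot H)=(n_1-1)n_2+\dim_s(K_1+H)$.
   Context: All graphs are finite and simple. $K_1$ is the one-vertex graph; the join $A+B$ joins every vertex of $A$ to every vertex of $B$ (disjoint copies). For $G$ with vertices $v_1,\dots,v_{n_1}$, the corona product $G\odot H$ is obtained from $G$ and $n_1$ disjoint copies $H_1,\dots,H_{n_1}$ of $H$ by joining $v_i$ to every vertex of $H_i$. For a connected graph $X$, $I_X[u,v]$ is the set of vertices on some shortest $u$–$v$ path; $w$ strongly resolves $u,v$ if $v\in I_X[u,w]$ or $u\in I_X[v,w]$; a strong resolving set is a set $S$ such that every two distinct vertices are strongly resolved by some vertex of $S$; the strong metric dimension $\dim_s(X)$ is the minimum size of a strong resolving set. -}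

module Defs where

open import Data.Nat using (ℕ; zero; suc; _+_; _*_; _∸_; _≤_; _<_; _⊔_)
open import Data.Bool using (Bool; true; false; T; if_then_else_; _∧_)
open import Data.Fin using (Fin; zero; suc; remQuot)
open import Data.Fin.Properties using (_≟_)
open import Data.Fin.Subset using (Subset; _∈_; ∣_∣)
open import Data.List using (List; foldr; map; allFin)
open import Data.Nat.ListAction using (sum)
open import Data.Product using (Σ; ∃; ∃₂; _×_; _,_; proj₁; proj₂)
open import Data.Sum using (_⊎_)
open import Relation.Binary.PropositionalEquality using (_≡_; _≢_; refl; sym)
open import Relation.Nullary using (¬_; does)

record Graph (n : ℕ) : Set where
  field
    adj    : Fin n → Fin n → Bool
    adj-sym : ∀ u v → adj u v ≡ adj v u
    adj-irr : ∀ v → adj v v ≡ false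
open Graph public

data Walk {n : ℕ} (G : Graph n) : Fin n → Fin n → Set where
  []  : ∀ {u} → Walk G u u
  _∷_ : ∀ {u v w} → T (adj G u v) → Walk G v w → Walk G u w

len : ∀ {n} {G : Graph n} {u v} → Walk G u v → ℕ
len []      = 0
len (_ ∷ p) = suc (len p)

_∈W_ : ∀ {n} {G : Graph n} {u v} → Fin n → Walk G u v → Set
_∈W_ {u = u} w []      = w ≡ u
_∈W_ {u = u} w (_ ∷ p) = (w ≡ u) ⊎ (w ∈W p)

-- a shortest u-v walk (necessarily a shortest path)
Shortest : ∀ {n} {G : Graph n} {u v} → Walk G u v → Set
Shortest {G = G} {u} {v} p = (q : Walk G u v) → len p ≤ len q

Connected : ∀ {n} → Graph n → Set
Connected G = ∀ u v → Walk G u v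

InInterval : ∀ {n} (G : Graph n) (u v w : Fin n) → Set
InInterval G u v w = Σ (Walk G u v) λ p → Shortest p × (w ∈W p)

StronglyResolves : ∀ {n} (G : Graph n) (w u v : Fin n) → Set
StronglyResolves G w u v = InInterval G u w v ⊎ InInterval G v w u

IsStrongResolvingSet : ∀ {n} (G : Graph n) → Subset n → Set
IsStrongResolvingSet G S =
  ∀ u v → u ≢ v → ∃ λ w → (w ∈ S) × StronglyResolves G w u v

IsStrongMetricDim : ∀ {n} (G : Graph n) → ℕ → Set
IsStrongMetricDim {n} G d =
  (Σ (Subset n) λ S → IsStrongResolvingSet G S × ∣ S ∣ ≡ d)
  × ((S : Subset n) → IsStrongResolvingSet G S → d ≤ ∣ S ∣)

degree : ∀ {n} → Graph n → Fin n → ℕ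
degree {n} G v = sum (map (λ u → if adj G v u then 1 else 0) (allFin n))

maxDegree : ∀ {n} → Graph n → ℕ
maxDegree {n} G = foldr _⊔_ 0 (map (degree G) (allFin n))

HasDiameter : ∀ {n} → Graph n → ℕ → Set
HasDiameter G d =
  Connected G
  × (∀ u v (p : Walk G u v) → Shortest p → len p ≤ d)
  × (∃₂ λ u v → Σ (Walk G u v) λ p → Shortest p × len p ≡ d)

DiameterGreaterThanTwo : ∀ {n} → Graph n → Set
DiameterGreaterThanTwo G =
  Connected G × (∃₂ λ u v → Σ (Walk G u v) λ p → Shortest p × 2 < len p)

-- join K₁ + H : vertex zero is the K₁ vertex, suc i is vertex i of H
joinAdj : ∀ {n} → Graph n → Fin (suc n) → Fin (suc n) → Bool
joinAdj H zero    zero    = false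
joinAdj H zero    (suc j) = true
joinAdj H (suc i) zero    = true
joinAdj H (suc i) (suc j) = adj H i j

K1+ : ∀ {n} → Graph n → Graph (suc n)
K1+ H = record { adj = joinAdj H ; adj-sym = s ; adj-irr = r }
  where
  s : ∀ u v → joinAdj H u v ≡ joinAdj H v u
  s zero zero = refl
  s zero (suc j) = refl
  s (suc i) zero = refl
  s (suc i) (suc j) = adj-sym H i j
  r : ∀ v → joinAdj H v v ≡ false
  r zero = refl
  r (suc i) = adj-irr H i

-- corona G ⊙ H : vertex (i , zero) is v_i of G, (i , suc h) is vertex h of H_i.
-- The vertex set Fin n₁ × Fin (suc n₂) is encoded as Fin (n₁ * suc n₂) via remQuot.
coronaAdjP : ∀ {n₁ n₂} → Graph n₁ → Graph n₂ →
             Fin n₁ × Fin (suc n₂) → Fin n₁ × Fin (suc n₂) → Bool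
coronaAdjP G H (i , zero)  (j , zero)  = adj G i j
coronaAdjP G H (i , zero)  (j , suc h) = does (i ≟ j)
coronaAdjP G H (i , suc h) (j , zero)  = does (i ≟ j)
coronaAdjP G H (i , suc h) (j , suc k) = does (i ≟ j) ∧ adj H h k

private
  ≟-sym : ∀ {m} (i j : Fin m) → does (i ≟ j) ≡ does (j ≟ i)
  ≟-sym i j with i ≟ j | j ≟ i
  ... | Relation.Nullary.yes _ | Relation.Nullary.yes _ = refl
  ... | Relation.Nullary.no _  | Relation.Nullary.no _  = refl
  ... | Relation.Nullary.yes p | Relation.Nullary.no q  = Data.Empty.⊥-elim (q (sym p))
    where import Data.Empty
  ... | Relation.Nullary.no q  | Relation.Nullary.yes p = Data.Empty.⊥-elim (q (sym p))
    where import Data.Empty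

  ∧-fix : ∀ {a b c d : Bool} → a ≡ c → b ≡ d → (a ∧ b) ≡ (c ∧ d)
  ∧-fix refl refl = refl

  ∧-false : ∀ (a : Bool) {b} → b ≡ false → (a ∧ b) ≡ false
  ∧-false false _ = refl
  ∧-false true p = p

coronaAdjP-sym : ∀ {n₁ n₂} (G : Graph n₁) (H : Graph n₂) x y →
                 coronaAdjP G H x y ≡ coronaAdjP G H y x
coronaAdjP-sym G H (i , zero)  (j , zero)  = adj-sym G i j
coronaAdjP-sym G H (i , zero)  (j , suc h) = ≟-sym i j
coronaAdjP-sym G H (i , suc h) (j , zero)  = ≟-sym i j
coronaAdjP-sym G H (i , suc h) (j , suc k) = ∧-fix (≟-sym i j) (adj-sym H h k)

coronaAdjP-irr : ∀ {n₁ n₂} (G : Graph n₁) (H : Graph n₂) x →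
                 coronaAdjP G H x x ≡ false
coronaAdjP-irr G H (i , zero)  = adj-irr G i
coronaAdjP-irr G H (i , suc h) = ∧-false (does (i ≟ i)) (adj-irr H h)

corona : ∀ {n₁ n₂} → Graph n₁ → Graph n₂ → Graph (n₁ * suc n₂)
corona {n₁} {n₂} G H = record
  { adj     = λ x y → coronaAdjP G H (remQuot (suc n₂) x) (remQuot (suc n₂) y)
  ; adj-sym = λ x y → coronaAdjP-sym G H (remQuot (suc n₂) x) (remQuot (suc n₂) y)
  ; adj-irr = λ x → coronaAdjP-irr G H (remQuot (suc n₂) x)
  }

-- When all distances are at most two, w strongly resolves u ≠ v exactly when w ∈ {u, v} or one of u, v is the
-- middle vertex of an induced path from the other one to w; call sets resolving in this sense local. K₁ + H and
-- every copy of H inside G ⊙ H see exactly the local structure of H.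
-- In G ⊙ H every shortest path leaving a copy H_i runs through its root v_i, so two vertices in different copies
-- are strongly resolved only by themselves: a strong resolving set contains all copies of H but one, and on the
-- remaining copy it is a local resolving set of H. Conversely such sets are strong resolving sets; the only pair
-- needing care is a root and a leaf of the remaining copy, resolved through a second copy when n₁ ≥ 2 or through a
-- non-neighbour of the leaf when H has no universal vertex.
-- In (i), a universal vertex of H and the apex of K₁ + H are adjacent twins, so exactly one more vertex is needed.
-- In (iii), H has no universal vertex, so every local resolving set of H also resolves the apex of K₁ + H.
module Submission where

open import Defs
open import Data.Bool using (true; false; T; _∧_; if_then_else_)
open import Data.Bool.Properties using (T?; T-∧)
open import Data.Empty using (⊥; ⊥-elim)
open import Data.Fin using (Fin; zero; suc; punchIn; punchOut; combine; remQuot; fromℕ<)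
open import Data.Fin.Properties
  using (_≟_; any?; suc-injective; punchInᵢ≢i; punchIn-punchOut; remQuot-combine; combine-remQuot;
         combine-injectiveˡ; combine-injectiveʳ)
open import Data.Fin.Subset using (Subset; _∈_; ∣_∣; ⊤; _-_)
open import Data.Fin.Subset.Properties
  using (_∈?_; ∈⊤; ∣p∣≤n; ∣p∣≤∣x∷p∣; ∣⊤∣≡n; p⊆q⇒∣p∣≤∣q∣; x∈p∧x≢y⇒x∈p-y; x∈p⇒∣p-x∣<∣p∣)
open import Data.List using (foldr; map)
import Data.List as List
open import Data.Nat using (ℕ; zero; suc; _+_; _*_; _∸_; _≤_; _<_; _⊔_; z≤n; s≤s)
open import Data.Nat.ListAction using (sum)
open import Data.Nat.Properties
  using (≤-refl; ≤-trans; ≤-reflexive; ≤-antisym; <-irrefl; ≤⇒≯; ≤-<-connex; ≤-<-trans; m<n⇒m<1+n; m≤n⇒m≤1+n;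
         +-comm; +-identityʳ; *-identityʳ; +-mono-≤; +-mono-<; +-mono-<-≤; +-mono-≤-<;
         m≤m⊔n; m≤n⊔m; ⊔-sel; ⊔-identityʳ; +-0-commutativeMonoid; <⇒≤; module ≤-Reasoning)
open import Algebra.Properties.CommutativeMonoid.Sum +-0-commutativeMonoid
  using (sum-remove; sum-cong-≗) renaming (sum to ∑)
open import Data.Product using (Σ; ∃; _×_; _,_; proj₁; proj₂; uncurry)
open import Data.Sum using (_⊎_; inj₁; inj₂; [_,_]′)
import Data.Sum as Sum
open import Data.Unit using (tt)
open import Data.Vec using (Vec; []; _∷_; _++_; concat; lookup; tail; tabulate; group; here; there)
open import Data.Vec.Properties using (lookup∘tabulate; lookup-concat; []=⇒lookup; lookup⇒[]=)
open import Function using (_∘_; id)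
open import Function.Bundles using (Equivalence)
open import Relation.Binary.PropositionalEquality
  using (_≡_; _≢_; refl; sym; trans; cong; cong₂; subst; subst₂; module ≡-Reasoning)
open import Relation.Nullary using (¬_; Dec; yes; no; does; ¬?; _×-dec_)
open import Relation.Nullary.Decidable using (decidable-stable; dec-true)

T-adj-sym : ∀ {n} (X : Graph n) {u v} → T (adj X u v) → T (adj X v u)
T-adj-sym X {u} {v} = subst T (adj-sym X u v)

Walk≤ : ∀ {n} → Graph n → ℕ → Fin n → Fin n → Set
Walk≤ X ℓ u v = Σ (Walk X u v) λ p → len p ≤ ℓ

module _ {n : ℕ} {X : Graph n} where

  infixr 5 _++ʷ_

  _++ʷ_ : ∀ {u v w} → Walk X u v → Walk X v w → Walk X u w
  []      ++ʷ q = q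
  (e ∷ p) ++ʷ q = e ∷ (p ++ʷ q)

  len-++ʷ : ∀ {u v w} (p : Walk X u v) (q : Walk X v w) → len (p ++ʷ q) ≡ len p + len q
  len-++ʷ []      q = refl
  len-++ʷ (e ∷ p) q = cong suc (len-++ʷ p q)

  reverseʷ : ∀ {u v} → Walk X u v → Walk X v u
  reverseʷ []      = []
  reverseʷ (e ∷ p) = reverseʷ p ++ʷ (T-adj-sym X e ∷ [])

  len-reverseʷ : ∀ {u v} (p : Walk X u v) → len (reverseʷ p) ≡ len p
  len-reverseʷ []      = refl
  len-reverseʷ (e ∷ p) =
    trans (len-++ʷ (reverseʷ p) _) (trans (+-comm (len (reverseʷ p)) 1) (cong suc (len-reverseʷ p)))

  len-reverse-++ʷ : ∀ {u v w} (r : Walk X v u) (q : Walk X v w) → len (reverseʷ r ++ʷ q) ≡ len r + len q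
  len-reverse-++ʷ r q = trans (len-++ʷ (reverseʷ r) q) (cong (_+ len q) (len-reverseʷ r))

  start∈ʷ : ∀ {u v} (p : Walk X u v) → u ∈W p
  start∈ʷ []      = refl
  start∈ʷ (e ∷ p) = inj₁ refl

  end∈ʷ : ∀ {u v} (p : Walk X u v) → v ∈W p
  end∈ʷ []      = refl
  end∈ʷ (e ∷ p) = inj₂ (end∈ʷ p)

  ∈ʷ-++⁺ˡ : ∀ {u v w x} (p : Walk X u v) (q : Walk X v w) → x ∈W p → x ∈W (p ++ʷ q)
  ∈ʷ-++⁺ˡ []      q refl      = start∈ʷ q
  ∈ʷ-++⁺ˡ (e ∷ p) q (inj₁ x≡) = inj₁ x≡
  ∈ʷ-++⁺ˡ (e ∷ p) q (inj₂ x∈) = inj₂ (∈ʷ-++⁺ˡ p q x∈)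

  ∈ʷ-++⁺ʳ : ∀ {u v w x} (p : Walk X u v) (q : Walk X v w) → x ∈W q → x ∈W (p ++ʷ q)
  ∈ʷ-++⁺ʳ []      q x∈ = x∈
  ∈ʷ-++⁺ʳ (e ∷ p) q x∈ = inj₂ (∈ʷ-++⁺ʳ p q x∈)

  splitʷ : ∀ {u v w} (p : Walk X u v) → w ∈W p →
           Σ (Walk X u w) λ p₁ → Σ (Walk X w v) λ p₂ → len p₁ + len p₂ ≡ len p
  splitʷ []      refl        = [] , [] , refl
  splitʷ (e ∷ p) (inj₁ refl) = [] , e ∷ p , refl
  splitʷ (e ∷ p) (inj₂ w∈)   with splitʷ p w∈
  ... | p₁ , p₂ , eq = e ∷ p₁ , p₂ , cong suc eq

  len≥1 : ∀ {u v} → u ≢ v → (p : Walk X u v) → 1 ≤ len p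
  len≥1 u≢v []      = ⊥-elim (u≢v refl)
  len≥1 u≢v (e ∷ p) = s≤s z≤n

module _ {n : ℕ} (X : Graph n) where

  walk≤? : ∀ ℓ u v → Dec (Walk≤ X ℓ u v)
  walk≤? ℓ u v with u ≟ v
  ... | yes refl = yes ([] , z≤n)
  walk≤? zero    u v | no u≢v = no λ { ([] , _) → u≢v refl ; ((_ ∷ _) , ()) }
  walk≤? (suc ℓ) u v | no u≢v with any? first-step?
    where
    first-step? : ∀ z → Dec (T (adj X u z) × Walk≤ X ℓ z v)
    first-step? z with adj X u z | walk≤? ℓ z v
    ... | true  | yes w = yes (tt , w)
    ... | true  | no ¬w = no λ { (_ , w) → ¬w w }
    ... | false | _     = no λ { (() , _) }
  ... | yes (z , e , p , p≤) = yes (e ∷ p , s≤s p≤)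
  ... | no ¬step = no λ { ([] , _) → u≢v refl ; (_∷_ {v = z} e p , s≤s p≤) → ¬step (z , e , p , p≤) }

module _ {n : ℕ} {X : Graph n} where

  -- Repeatedly replace the walk by a strictly shorter one while one exists.
  shortestʷ : ∀ {u v} → Walk X u v → Σ (Walk X u v) Shortest
  shortestʷ {u} {v} p = go (len p) p ≤-refl
    where
    go : ∀ m (p : Walk X u v) → len p ≤ m → Σ (Walk X u v) Shortest
    go m       []      _        = [] , λ q → z≤n
    go (suc m) (e ∷ p) (s≤s p≤) with walk≤? X (len p) u v
    ... | yes (q , q≤) = go m q (≤-trans q≤ p≤)
    ... | no ¬shorter  = e ∷ p , minimal
      where
      minimal : ∀ q → suc (len p) ≤ len q
      minimal q with ≤-<-connex (suc (len p)) (len q)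
      ... | inj₁ ≤q       = ≤q
      ... | inj₂ (s≤s q≤) = ⊥-elim (¬shorter (q , q≤))

  shortcut : ∀ {u v} {p : Walk X u v} → Shortest p → (q : Walk X u v) → len q < len p → ⊥
  shortcut p-short q q<p = <-irrefl refl (≤-<-trans (p-short q) q<p)

  end∈interval : ∀ {u w} → Walk X u w → InInterval X u w w
  end∈interval p with shortestʷ p
  ... | q , q-short = q , q-short , end∈ʷ q

-- Strong resolution in graphs of diameter at most two

-- When d(u, w) = 2, this says v ∈ I[u, w] ∖ {u, w}.
Between : ∀ {n} → Graph n → Fin n → Fin n → Fin n → Set
Between X u v w = T (adj X u v) × T (adj X v w) × ¬ T (adj X u w) × u ≢ w

-- The ways in which w strongly resolves u and v in a graph of diameter at most two.
data LocallyResolves {n} (X : Graph n) (w u v : Fin n) : Set where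
  is-left   : w ≡ u → LocallyResolves X w u v
  is-right  : w ≡ v → LocallyResolves X w u v
  via-right : Between X u v w → LocallyResolves X w u v
  via-left  : Between X v u w → LocallyResolves X w u v

IsLocalResolvingSet : ∀ {n} → Graph n → Subset n → Set
IsLocalResolvingSet X S = ∀ u v → u ≢ v → ∃ λ w → w ∈ S × LocallyResolves X w u v

IsLocalMetricDim : ∀ {n} → Graph n → ℕ → Set
IsLocalMetricDim {n} X d =
  (Σ (Subset n) λ S → IsLocalResolvingSet X S × ∣ S ∣ ≡ d)
  × (∀ S → IsLocalResolvingSet X S → d ≤ ∣ S ∣)

DiameterAtMostTwo : ∀ {n} → Graph n → Set
DiameterAtMostTwo X = ∀ u v → Walk≤ X 2 u v

module _ {n : ℕ} {X : Graph n} where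

  interval⇒between : ∀ {u w v} → InInterval X u w v → v ≢ u → v ≢ w → Walk≤ X 2 u w → Between X u v w
  interval⇒between ([]                 , _     , v≡u)              v≢u _   _ = ⊥-elim (v≢u v≡u)
  interval⇒between ((_ ∷ [])           , _     , inj₁ v≡u)         v≢u _   _ = ⊥-elim (v≢u v≡u)
  interval⇒between ((_ ∷ [])           , _     , inj₂ v≡w)         _   v≢w _ = ⊥-elim (v≢w v≡w)
  interval⇒between ((_ ∷ (_ ∷ []))     , _     , inj₁ v≡u)         v≢u _   _ = ⊥-elim (v≢u v≡u)
  interval⇒between ((_ ∷ (_ ∷ []))     , _     , inj₂ (inj₂ v≡w))  _   v≢w _ = ⊥-elim (v≢w v≡w)
  interval⇒between ((e ∷ (f ∷ []))     , short , inj₂ (inj₁ refl)) _   _   _ =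
    e , f , (λ g → <-irrefl refl (short (g ∷ []))) , λ { refl → <-irrefl refl (≤-trans (s≤s z≤n) (short [])) }
  interval⇒between ((_ ∷ (_ ∷ (_ ∷ _))) , short , _)                _   _   (q , q≤2) =
    ⊥-elim (≤⇒≯ (≤-trans (short q) q≤2) (s≤s (s≤s (s≤s z≤n))))

  between⇒interval : ∀ {u v w} → Between X u v w → InInterval X u w v
  between⇒interval (e , f , ¬uw , u≢w) = (e ∷ (f ∷ [])) , short , inj₂ (inj₁ refl)
    where
    short : Shortest (e ∷ (f ∷ []))
    short []            = ⊥-elim (u≢w refl)
    short (g ∷ [])      = ⊥-elim (¬uw g)
    short (_ ∷ (_ ∷ _)) = s≤s (s≤s z≤n)

  resolves⇒local : ∀ {w u v} → StronglyResolves X w u v → u ≢ v → Walk≤ X 2 u w → Walk≤ X 2 v w →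
                   LocallyResolves X w u v
  resolves⇒local {w} {u} {v} (inj₁ v∈) u≢v uw _ with v ≟ w
  ... | yes refl = is-right refl
  ... | no v≢w   = via-right (interval⇒between v∈ (u≢v ∘ sym) v≢w uw)
  resolves⇒local {w} {u} {v} (inj₂ u∈) u≢v _ vw with u ≟ w
  ... | yes refl = is-left refl
  ... | no u≢w   = via-left (interval⇒between u∈ u≢v u≢w vw)

  local⇒resolves : ∀ {w u v} → LocallyResolves X w u v → Walk X u v → StronglyResolves X w u v
  local⇒resolves (is-left refl)  p = inj₂ (end∈interval (reverseʷ p))
  local⇒resolves (is-right refl) p = inj₁ (end∈interval p)
  local⇒resolves (via-right b)   _ = inj₁ (between⇒interval b)
  local⇒resolves (via-left b)    _ = inj₂ (between⇒interval b)

  resolves-sym : ∀ {w u v} → StronglyResolves X w u v → StronglyResolves X w v u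
  resolves-sym (inj₁ r) = inj₂ r
  resolves-sym (inj₂ r) = inj₁ r

  local-sym : ∀ {w u v} → LocallyResolves X w u v → LocallyResolves X w v u
  local-sym (is-left e)   = is-right e
  local-sym (is-right e)  = is-left e
  local-sym (via-right b) = via-left b
  local-sym (via-left b)  = via-right b

module _ {n : ℕ} {X : Graph n} (diam₂ : DiameterAtMostTwo X) where

  strong⇒local : ∀ {S} → IsStrongResolvingSet X S → IsLocalResolvingSet X S
  strong⇒local sr u v u≢v with sr u v u≢v
  ... | w , w∈S , r = w , w∈S , resolves⇒local r u≢v (diam₂ u w) (diam₂ v w)

  local⇒strong : ∀ {S} → IsLocalResolvingSet X S → IsStrongResolvingSet X S
  local⇒strong lr u v u≢v with lr u v u≢v
  ... | w , w∈S , r = w , w∈S , local⇒resolves r (proj₁ (diam₂ u v))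

  strongDim⇒localDim : ∀ {d} → IsStrongMetricDim X d → IsLocalMetricDim X d
  strongDim⇒localDim ((S , S-res , ∣S∣≡d) , minimal) =
    (S , strong⇒local S-res , ∣S∣≡d) , λ S lr → minimal S (local⇒strong lr)

  localDim⇒strongDim : ∀ {d} → IsLocalMetricDim X d → IsStrongMetricDim X d
  localDim⇒strongDim ((S , S-res , ∣S∣≡d) , minimal) =
    (S , local⇒strong S-res , ∣S∣≡d) , λ S sr → minimal S (strong⇒local sr)

⨆ : ∀ {m} → (Fin m → ℕ) → ℕ
⨆ {zero}  f = 0
⨆ {suc m} f = f zero ⊔ ⨆ (f ∘ suc)

sum-map-tabulate : ∀ {A : Set} m (g : Fin m → A) (f : A → ℕ) → sum (map f (List.tabulate g)) ≡ ∑ (f ∘ g)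
sum-map-tabulate zero    g f = refl
sum-map-tabulate (suc m) g f = cong (f (g zero) +_) (sum-map-tabulate m (g ∘ suc) f)

max-map-tabulate : ∀ {A : Set} m (g : Fin m → A) (f : A → ℕ) →
                   foldr _⊔_ 0 (map f (List.tabulate g)) ≡ ⨆ (f ∘ g)
max-map-tabulate zero    g f = refl
max-map-tabulate (suc m) g f = cong (f (g zero) ⊔_) (max-map-tabulate m (g ∘ suc) f)

⨆-upper : ∀ {m} (f : Fin m → ℕ) v → f v ≤ ⨆ f
⨆-upper f zero    = m≤m⊔n (f zero) _
⨆-upper f (suc v) = ≤-trans (⨆-upper (f ∘ suc) v) (m≤n⊔m (f zero) _)

⨆-attained : ∀ {m} (f : Fin (suc m) → ℕ) → ∃ λ v → ⨆ f ≡ f v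
⨆-attained {zero}  f = zero , ⊔-identityʳ (f zero)
⨆-attained {suc m} f with ⨆-attained (f ∘ suc) | ⊔-sel (f zero) (⨆ (f ∘ suc))
... | v , eq | inj₁ at-zero = zero , at-zero
... | v , eq | inj₂ at-rest = suc v , trans at-rest eq

∑-mono : ∀ {m} {f g : Fin m → ℕ} → (∀ i → f i ≤ g i) → ∑ f ≤ ∑ g
∑-mono {zero}  f≤g = z≤n
∑-mono {suc m} f≤g = +-mono-≤ (f≤g zero) (∑-mono (f≤g ∘ suc))

∑-const : ∀ m b → ∑ {m} (λ _ → b) ≡ m * b
∑-const zero    b = refl
∑-const (suc m) b = cong (b +_) (∑-const m b)

∑-≥-except : ∀ {m} (f : Fin (suc m) → ℕ) {a b} i₀ → (∀ i → i ≢ i₀ → b ≤ f i) → a ≤ f i₀ →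
             m * b + a ≤ ∑ f
∑-≥-except {m} f {a} {b} i₀ b≤f a≤f =
  subst₂ _≤_ (cong (_+ a) (∑-const m b)) (trans (+-comm _ (f i₀)) (sym (sum-remove {i = i₀} f)))
    (+-mono-≤ (∑-mono λ j → b≤f (punchIn i₀ j) (punchInᵢ≢i i₀ j)) a≤f)

∑-≡-except : ∀ {m} (f : Fin (suc m) → ℕ) {a b} i₀ → (∀ i → i ≢ i₀ → f i ≡ b) → f i₀ ≡ a →
             ∑ f ≡ m * b + a
∑-≡-except {m} f {a} {b} i₀ f≡b f≡a = begin
  ∑ f                          ≡⟨ sum-remove {i = i₀} f ⟩
  f i₀ + ∑ (f ∘ punchIn i₀)    ≡⟨ cong₂ _+_ f≡a (sum-cong-≗ λ j → f≡b (punchIn i₀ j) (punchInᵢ≢i i₀ j)) ⟩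
  a + ∑ {m} (λ _ → b)          ≡⟨ cong (a +_) (∑-const m b) ⟩
  a + m * b                    ≡⟨ +-comm a (m * b) ⟩
  m * b + a                    ∎
  where open ≡-Reasoning

∑-≤1-zero : ∀ {m} (f : Fin m → ℕ) → (∀ x → f x ≤ 1) → ∀ v → f v ≡ 0 → suc (∑ f) ≤ m
∑-≤1-zero {suc m} f f≤1 v fv≡0 =
  subst (λ s → suc s ≤ suc m) (sym (trans (sum-remove {i = v} f) (cong (_+ ∑ (f ∘ punchIn v)) fv≡0)))
    (s≤s (subst (∑ (f ∘ punchIn v) ≤_) (trans (∑-const m 1) (*-identityʳ m)) (∑-mono (f≤1 ∘ punchIn v))))

∑-≤1-zero₂ : ∀ {m} (f : Fin m → ℕ) → (∀ x → f x ≤ 1) → ∀ {v c} → v ≢ c → f v ≡ 0 → f c ≡ 0 →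
             2 + ∑ f ≤ m
∑-≤1-zero₂ {suc m} f f≤1 {v} {c} v≢c fv≡0 fc≡0 =
  subst (λ s → 2 + s ≤ suc m) (sym (trans (sum-remove {i = v} f) (cong (_+ ∑ (f ∘ punchIn v)) fv≡0)))
    (s≤s (∑-≤1-zero (f ∘ punchIn v) (f≤1 ∘ punchIn v) (punchOut v≢c)
           (trans (cong f (punchIn-punchOut v≢c)) fc≡0)))

module _ {n : ℕ} (H : Graph n) where

  Universal : Fin n → Set
  Universal u = ∀ h → h ≢ u → T (adj H u h)

  adj-universal : ∀ {u} → Universal u → ∀ h → h ≢ u → T (adj H h u)
  adj-universal univ h h≢u = T-adj-sym H (univ h h≢u)

  NonNeighbour : Fin n → Fin n → Set
  NonNeighbour u c = c ≢ u × ¬ T (adj H u c)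

  NoUniversal : Set
  NoUniversal = ∀ u → ∃ (NonNeighbour u)

  universal⊎nonNeighbour : ∀ u → Universal u ⊎ ∃ (NonNeighbour u)
  universal⊎nonNeighbour u with any? (λ c → ¬? (c ≟ u) ×-dec ¬? (T? (adj H u c)))
  ... | yes non = inj₂ non
  ... | no ¬non = inj₁ λ h h≢u → decidable-stable (T? (adj H u h)) λ ¬uh → ¬non (h , h≢u , ¬uh)

  universal⇒diameter≤2 : ∀ {u} → Universal u → DiameterAtMostTwo H
  universal⇒diameter≤2 {u} univ a b with a ≟ b | a ≟ u | b ≟ u
  ... | yes refl | _        | _        = [] , z≤n
  ... | no a≢b   | yes refl | _        = (univ b (a≢b ∘ sym) ∷ []) , s≤s z≤n
  ... | no a≢b   | no a≢u   | yes refl = (adj-universal univ a a≢u ∷ []) , s≤s z≤n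
  ... | no a≢b   | no a≢u   | no b≢u   = (adj-universal univ a a≢u ∷ (univ b b≢u ∷ [])) , s≤s (s≤s z≤n)

  neighbourIndicator : Fin n → Fin n → ℕ
  neighbourIndicator v x = if adj H v x then 1 else 0

  neighbourIndicator≤1 : ∀ v x → neighbourIndicator v x ≤ 1
  neighbourIndicator≤1 v x with adj H v x
  ... | true  = ≤-refl
  ... | false = z≤n

  degree≡∑ : ∀ v → degree H v ≡ ∑ (neighbourIndicator v)
  degree≡∑ v = sum-map-tabulate n id (neighbourIndicator v)

  degree≤maxDegree : ∀ v → degree H v ≤ maxDegree H
  degree≤maxDegree v = subst (degree H v ≤_) (sym (max-map-tabulate n id (degree H))) (⨆-upper (degree H) v)

  nonNeighbour⇒degree≤n-2 : ∀ {u c} → NonNeighbour u c → 2 + degree H u ≤ n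
  nonNeighbour⇒degree≤n-2 {u} {c} (c≢u , ¬uc) =
    subst (λ d → 2 + d ≤ n) (sym (degree≡∑ u))
      (∑-≤1-zero₂ (neighbourIndicator u) (neighbourIndicator≤1 u) (c≢u ∘ sym)
                  (absent (subst T (adj-irr H u))) (absent ¬uc))
    where
    absent : ∀ {x} → ¬ T (adj H u x) → neighbourIndicator u x ≡ 0
    absent {x} ¬ux with adj H u x
    ... | false = refl
    ... | true  = ⊥-elim (¬ux tt)

universal⇒degree≡n-1 : ∀ {m} (H : Graph (suc m)) {u} → Universal H u → degree H u ≡ m
universal⇒degree≡n-1 {m} H {u} univ = begin
  degree H u                       ≡⟨ degree≡∑ H u ⟩
  ∑ (neighbourIndicator H u)       ≡⟨ ∑-≡-except (neighbourIndicator H u) u present absent ⟩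
  m * 1 + 0                        ≡⟨ trans (+-identityʳ (m * 1)) (*-identityʳ m) ⟩
  m                                ∎
  where
  open ≡-Reasoning
  present : ∀ x → x ≢ u → neighbourIndicator H u x ≡ 1
  present x x≢u with adj H u x | univ x x≢u
  ... | true | _ = refl
  absent : neighbourIndicator H u u ≡ 0
  absent rewrite adj-irr H u = refl

maxDegree≡n-1⇒universal : ∀ {m} (H : Graph (suc m)) → maxDegree H ≡ m → ∃ (Universal H)
maxDegree≡n-1⇒universal {m} H Δ≡m with ⨆-attained (degree H)
... | u , max≡deg = u , λ h h≢u → decidable-stable (T? (adj H u h)) λ ¬uh →
  <-irrefl refl (subst (λ d → 2 + d ≤ suc m) deg≡m (nonNeighbour⇒degree≤n-2 H (h≢u , ¬uh)))
  where
  deg≡m : degree H u ≡ m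
  deg≡m = trans (sym max≡deg) (trans (sym (max-map-tabulate (suc m) id (degree H))) Δ≡m)

local-resolver-nonNeighbour : ∀ {n} {H : Graph n} {R b b′} → IsLocalResolvingSet H R → NonNeighbour H b b′ →
                              ∃ λ c → c ∈ R × (c ≡ b ⊎ NonNeighbour H b c)
local-resolver-nonNeighbour {H = H} {b = b} R-res (b′≢b , ¬bb′) with R-res b _ (b′≢b ∘ sym)
... | c , c∈R , is-left c≡b         = c , c∈R , inj₁ c≡b
... | c , c∈R , is-right refl       = c , c∈R , inj₂ (b′≢b , ¬bb′)
... | c , c∈R , via-right (bb′ , _) = ⊥-elim (¬bb′ bb′)
... | c , c∈R , via-left (b′b , _)  = ⊥-elim (¬bb′ (T-adj-sym H b′b))

∣++∣ : ∀ {a b} (p : Subset a) (q : Subset b) → ∣ p ++ q ∣ ≡ ∣ p ∣ + ∣ q ∣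
∣++∣ []          q = refl
∣++∣ (true ∷ p)  q = cong suc (∣++∣ p q)
∣++∣ (false ∷ p) q = ∣++∣ p q

∣concat∣ : ∀ {m k} (ps : Vec (Subset k) m) → ∣ concat ps ∣ ≡ ∑ (λ i → ∣ lookup ps i ∣)
∣concat∣ []       = refl
∣concat∣ (p ∷ ps) = trans (∣++∣ p (concat ps)) (cong (∣ p ∣ +_) (∣concat∣ ps))

module _ {m k : ℕ} (ps : Vec (Subset k) m) (i : Fin m) {t : Fin k} where

  ∈-concat⁺ : t ∈ lookup ps i → combine i t ∈ concat ps
  ∈-concat⁺ t∈ = lookup⇒[]= _ _ (trans (lookup-concat ps i t) ([]=⇒lookup t∈))

  ∈-concat⁻ : combine i t ∈ concat ps → t ∈ lookup ps i
  ∈-concat⁻ ct∈ = lookup⇒[]= _ _ (trans (sym (lookup-concat ps i t)) ([]=⇒lookup ct∈))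

∈-tail⁺ : ∀ {k} {p : Subset (suc k)} {t} → suc t ∈ p → t ∈ tail p
∈-tail⁺ {p = _ ∷ _} (there t∈) = t∈

∣tail∣≤∣p∣ : ∀ {k} (p : Subset (suc k)) → ∣ tail p ∣ ≤ ∣ p ∣
∣tail∣≤∣p∣ (x ∷ p) = ∣p∣≤∣x∷p∣ x p

full⇒∣p∣≡n : ∀ {k} (p : Subset k) → (∀ t → t ∈ p) → ∣ p ∣ ≡ k
full⇒∣p∣≡n {k} p all∈ =
  ≤-antisym (∣p∣≤n p) (subst (_≤ ∣ p ∣) (∣⊤∣≡n k) (p⊆q⇒∣p∣≤∣q∣ {p = ⊤} λ {t} _ → all∈ t))

-- The corona G ⊙ H

does-≟-refl : ∀ {m} (i : Fin m) → T (does (i ≟ i))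
does-≟-refl i = subst T (sym (dec-true (i ≟ i) refl)) tt

does-≟⇒≡ : ∀ {m} {i j : Fin m} → T (does (i ≟ j)) → i ≡ j
does-≟⇒≡ {i = i} {j} t with i ≟ j
... | yes i≡j = i≡j

module Corona {n₁ n₂ : ℕ} (G : Graph n₁) (H : Graph n₂) where

  X : Graph (n₁ * suc n₂)
  X = corona G H

  pos : Fin (n₁ * suc n₂) → Fin n₁ × Fin (suc n₂)
  pos = remQuot (suc n₂)

  root : Fin n₁ → Fin (n₁ * suc n₂)
  root i = combine i zero

  leaf : Fin n₁ → Fin n₂ → Fin (n₁ * suc n₂)
  leaf i h = combine i (suc h)

  InCopy : Fin n₁ → Fin (n₁ * suc n₂) → Set
  InCopy j x = ∃ λ h → x ≡ leaf j h

  inCopy? : ∀ j x → Dec (InCopy j x)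
  inCopy? j x = any? λ h → x ≟ leaf j h

  combine-pos : ∀ x → combine {n₁} (proj₁ (pos x)) (proj₂ (pos x)) ≡ x
  combine-pos = combine-remQuot {n₁} (suc n₂)

  adj-combine : ∀ i t j s → adj X (combine i t) (combine j s) ≡ coronaAdjP G H (i , t) (j , s)
  adj-combine i t j s = cong₂ (coronaAdjP G H) (remQuot-combine i t) (remQuot-combine j s)

  adj-roots : ∀ i j → adj X (root i) (root j) ≡ adj G i j
  adj-roots i j = adj-combine i zero j zero

  adj-leaves : ∀ i a b → adj X (leaf i a) (leaf i b) ≡ adj H a b
  adj-leaves i a b = trans (adj-combine i (suc a) i (suc b)) (cong (_∧ adj H a b) (dec-true (i ≟ i) refl))

  leaf-root-adj : ∀ {i h} → T (adj X (leaf i h) (root i))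
  leaf-root-adj {i} {h} = subst T (sym (adj-combine i (suc h) i zero)) (does-≟-refl i)

  root-leaf-adj : ∀ {i h} → T (adj X (root i) (leaf i h))
  root-leaf-adj {i} {h} = subst T (sym (adj-combine i zero i (suc h))) (does-≟-refl i)

  via-root : ∀ i a b → Walk X (leaf i a) (leaf i b)
  via-root i a b = leaf-root-adj {i} {a} ∷ (root-leaf-adj {i} {b} ∷ [])

  leaf-injective : ∀ {i j a b} → leaf i a ≡ leaf j b → a ≡ b
  leaf-injective {i} {j} {a} {b} eq = suc-injective (combine-injectiveʳ i (suc a) j (suc b) eq)

  leaf∉copy : ∀ {i j h} → i ≢ j → ¬ InCopy j (leaf i h)
  leaf∉copy {i} {j} {h} i≢j (k , eq) = i≢j (combine-injectiveˡ i (suc h) j (suc k) eq)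

  root∉copy : ∀ {i j} → ¬ InCopy j (root i)
  root∉copy {i} {j} (k , eq) with combine-injectiveʳ i zero j (suc k) eq
  ... | ()

  leaf-neighbour : ∀ {j h y} → T (adj X (leaf j h) y) → y ≡ root j ⊎ InCopy j y
  leaf-neighbour {j} {h} {y} e =
    Sum.map (λ eq → trans (sym (combine-pos y)) (cong (uncurry combine) eq))
            (λ { (h' , eq) → h' , trans (sym (combine-pos y)) (cong (uncurry combine) eq) })
            (step (pos y) (subst T (adj-combine′ y) e))
    where
    adj-combine′ : ∀ y → adj X (leaf j h) y ≡ coronaAdjP G H (j , suc h) (pos y)
    adj-combine′ y = cong (λ p → coronaAdjP G H p (pos y)) (remQuot-combine j (suc h))
    step : ∀ q → T (coronaAdjP G H (j , suc h) q) → q ≡ (j , zero) ⊎ ∃ λ h' → q ≡ (j , suc h')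
    step (j' , zero)    t with does-≟⇒≡ {i = j} {j'} t
    ... | refl = inj₁ refl
    step (j' , suc h')  t with does-≟⇒≡ {i = j} {j'} (proj₁ (Equivalence.to T-∧ t))
    ... | refl = inj₂ (h' , refl)

  leaveCopy : ∀ {j y a} (q : Walk X y a) → InCopy j y → ¬ InCopy j a →
              Σ (Walk X (root j) a) λ q′ → len q′ < len q
  leaveCopy []      y∈ a∉ = ⊥-elim (a∉ y∈)
  leaveCopy (e ∷ q) (h , refl) a∉ with leaf-neighbour e
  ... | inj₁ refl = q , ≤-refl
  ... | inj₂ y′∈ with leaveCopy q y′∈ a∉
  ...   | q′ , q′< = q′ , m<n⇒m<1+n q′<

  projectWalk : ∀ {x y i j} → proj₁ (pos x) ≡ i → proj₁ (pos y) ≡ j → (q : Walk X x y) →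
                Σ (Walk G i j) λ g → len g ≤ len q
  projectWalk refl refl [] = [] , z≤n
  projectWalk {x} refl y≡j (_∷_ {v = v} e q) with step (pos x) (pos v) e
    where
    step : ∀ p r → T (coronaAdjP G H p r) → proj₁ p ≡ proj₁ r ⊎ T (adj G (proj₁ p) (proj₁ r))
    step (i , zero)  (j , zero)  t = inj₂ t
    step (i , zero)  (j , suc h) t = inj₁ (does-≟⇒≡ t)
    step (i , suc h) (j , zero)  t = inj₁ (does-≟⇒≡ t)
    step (i , suc h) (j , suc k) t = inj₁ (does-≟⇒≡ (proj₁ (Equivalence.to T-∧ t)))
  ... | inj₁ same with projectWalk (sym same) y≡j q
  ...   | g , g≤ = g , m≤n⇒m≤1+n g≤
  projectWalk {x} refl y≡j (_∷_ {v = v} e q) | inj₂ e′ with projectWalk refl y≡j q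
  ...   | g , g≤ = e′ ∷ g , s≤s g≤

  projectRoots : ∀ {i j} (q : Walk X (root i) (root j)) → Σ (Walk G i j) λ g → len g ≤ len q
  projectRoots {i} {j} = projectWalk (cong proj₁ (remQuot-combine i zero)) (cong proj₁ (remQuot-combine j zero))

  embedWalk : ∀ {i j} (g : Walk G i j) → Σ (Walk X (root i) (root j)) λ q → len q ≡ len g
  embedWalk []      = [] , refl
  embedWalk {i} (_∷_ {v = k} e g) with embedWalk g
  ... | q , q≡ = subst T (sym (adj-roots i k)) e ∷ q , cong suc q≡

  toRoot : ∀ i t → Walk X (combine i t) (root i)
  toRoot i zero    = []
  toRoot i (suc h) = leaf-root-adj ∷ []

  connected : Connected G → Connected X
  connected G-conn x y = subst₂ (Walk X) (combine-pos x) (combine-pos y)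
    (toRoot _ _ ++ʷ proj₁ (embedWalk (G-conn _ _)) ++ʷ reverseʷ (toRoot _ _))

  from-root : ∀ {j y w} → InCopy j y → y ≢ w → (q : Walk X y w) → Σ (Walk X (root j) w) λ r → len r ≤ len q
  from-root {j} {w = w} y∈ y≢w q with inCopy? j w
  ... | yes (c , refl) = (root-leaf-adj ∷ []) , len≥1 y≢w q
  ... | no w∉ with leaveCopy q y∈ w∉
  ...   | r , r< = r , <⇒≤ r<

  interval-across-copies : ∀ {i j h k w} → i ≢ j → InInterval X (leaf i h) w (leaf j k) → w ≡ leaf j k
  interval-across-copies {i} {j} {h} {k} {w} i≢j (p , p-short , y∈p) with w ≟ leaf j k
  ... | yes w≡y = w≡y
  ... | no w≢y with splitʷ p y∈p
  ...   | p₁ , p₂ , len≡ with leaveCopy (reverseʷ p₁) (k , refl) (leaf∉copy i≢j)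
                           | from-root (k , refl) (w≢y ∘ sym) p₂
  ...     | r₁ , r₁< | r₂ , r₂≤ =
    ⊥-elim (shortcut p-short (reverseʷ r₁ ++ʷ r₂)
             (subst₂ _<_ (sym (len-reverse-++ʷ r₁ r₂)) len≡
                     (+-mono-<-≤ (subst (len r₁ <_) (len-reverseʷ p₁) r₁<) r₂≤)))

  between-leaves⁺ : ∀ {i a b c} → Between H a b c → Between X (leaf i a) (leaf i b) (leaf i c)
  between-leaves⁺ {i} {a} {b} {c} (ab , bc , ¬ac , a≢c) =
    subst T (sym (adj-leaves i a b)) ab , subst T (sym (adj-leaves i b c)) bc ,
    ¬ac ∘ subst T (adj-leaves i a c) , a≢c ∘ leaf-injective

  between-leaves⁻ : ∀ {i a b c} → Between X (leaf i a) (leaf i b) (leaf i c) → Between H a b c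
  between-leaves⁻ {i} {a} {b} {c} (ab , bc , ¬ac , a≢c) =
    subst T (adj-leaves i a b) ab , subst T (adj-leaves i b c) bc ,
    ¬ac ∘ subst T (sym (adj-leaves i a c)) , a≢c ∘ cong (leaf i)

  local-leaves⁺ : ∀ {i a b c} → LocallyResolves H c a b → LocallyResolves X (leaf i c) (leaf i a) (leaf i b)
  local-leaves⁺ (is-left refl)  = is-left refl
  local-leaves⁺ (is-right refl) = is-right refl
  local-leaves⁺ (via-right bw)  = via-right (between-leaves⁺ bw)
  local-leaves⁺ (via-left bw)   = via-left (between-leaves⁺ bw)

  interval-within-copy : ∀ {i a b w} → a ≢ b → InInterval X (leaf i a) w (leaf i b) → w ≢ leaf i b →
                         ∃ λ c → w ≡ leaf i c × Between H a b c
  interval-within-copy {i} {a} {b} {w} a≢b b∈ w≢b with inCopy? i w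
  ... | yes (c , refl) =
    c , refl , between-leaves⁻ (interval⇒between b∈ (a≢b ∘ sym ∘ leaf-injective) (w≢b ∘ sym)
                                  (via-root i a c , ≤-refl))
  ... | no w∉ with b∈
  ...   | p , p-short , b∈p with splitʷ p b∈p
  ...     | p₁ , p₂ , len≡ with leaveCopy p₂ (b , refl) w∉
  ...       | r , r< = ⊥-elim (shortcut p-short (leaf-root-adj ∷ r)
                         (subst (suc (len r) <_) len≡ (+-mono-≤-< (len≥1 (a≢b ∘ leaf-injective {i} {i}) p₁) r<)))

  module _ (G-conn : Connected G) where

    private
      shortest≤ : ∀ {i j} {g : Walk G i j} → Shortest g → (r : Walk X (root j) (root i)) → len g ≤ len r
      shortest≤ {g = g} g-short r with projectRoots r
      ... | g₁ , g₁≤ = ≤-trans (g-short (reverseʷ g₁)) (≤-trans (≤-reflexive (len-reverseʷ g₁)) g₁≤)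

    root-on-geodesic : ∀ i j h → InInterval X (root i) (leaf j h) (root j)
    root-on-geodesic i j h with shortestʷ (G-conn i j)
    ... | g , g-short with embedWalk g
    ...   | eg , eg≡ = W , W-short , ∈ʷ-++⁺ʳ eg _ (inj₁ refl)
      where
      W : Walk X (root i) (leaf j h)
      W = eg ++ʷ (root-leaf-adj ∷ [])
      W-short : Shortest W
      W-short q with leaveCopy (reverseʷ q) (h , refl) root∉copy
      ... | r , r< = begin
        len W              ≡⟨ trans (len-++ʷ eg _) (trans (cong (_+ 1) eg≡) (+-comm (len g) 1)) ⟩
        suc (len g)        ≤⟨ s≤s (shortest≤ g-short r) ⟩
        suc (len r)        ≤⟨ subst (len r <_) (len-reverseʷ q) r< ⟩
        len q              ∎
        where open ≤-Reasoning

    geodesic-via-roots : ∀ {i j} → i ≢ j → ∀ b h →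
      Σ (Walk X (leaf j b) (leaf i h)) λ W → Shortest W × root i ∈W W × root j ∈W W
    geodesic-via-roots {i} {j} i≢j b h with shortestʷ (G-conn j i)
    ... | g , g-short with embedWalk g
    ...   | eg , eg≡ =
      W , W-short , inj₂ (∈ʷ-++⁺ʳ eg _ (inj₁ refl)) , inj₂ (∈ʷ-++⁺ˡ eg _ (start∈ʷ eg))
      where
      W : Walk X (leaf j b) (leaf i h)
      W = leaf-root-adj ∷ (eg ++ʷ (root-leaf-adj ∷ []))
      W-short : Shortest W
      W-short q with leaveCopy q (b , refl) (leaf∉copy i≢j)
      ... | r , r< with leaveCopy (reverseʷ r) (h , refl) root∉copy
      ...   | r′ , r′< = begin
        len W                  ≡⟨ cong suc (trans (len-++ʷ eg _) (trans (cong (_+ 1) eg≡) (+-comm (len g) 1))) ⟩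
        suc (suc (len g))      ≤⟨ s≤s (s≤s (shortest≤ g-short r′)) ⟩
        suc (suc (len r′))     ≤⟨ s≤s (subst (len r′ <_) (len-reverseʷ r) r′<) ⟩
        suc (len r)            ≤⟨ r< ⟩
        len q                  ∎
        where open ≤-Reasoning

  resolving-by-positions : ∀ S →
    (∀ (i : Fin n₁) t j (s : Fin (suc n₂)) → combine i t ≢ combine j s →
       ∃ λ w → w ∈ S × StronglyResolves X w (combine i t) (combine j s)) →
    IsStrongResolvingSet X S
  resolving-by-positions S resolve x y x≢y =
    subst₂ (λ x y → ∃ λ w → w ∈ S × StronglyResolves X w x y) (combine-pos x) (combine-pos y)
      (resolve (proj₁ (pos x)) (proj₂ (pos x)) (proj₁ (pos y)) (proj₂ (pos y))
               λ eq → x≢y (trans (sym (combine-pos x)) (trans eq (combine-pos y))))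

module CoronaDimension {m n₂ : ℕ} (G : Graph (suc m)) (H : Graph n₂) where
  open Corona G H

  blocks : Subset (suc m * suc n₂) → Vec (Subset (suc n₂)) (suc m)
  blocks S = proj₁ (group (suc m) (suc n₂) S)

  concat-blocks : ∀ S → S ≡ concat (blocks S)
  concat-blocks S = proj₂ (group (suc m) (suc n₂) S)

  -- S ∩ V(H_i), read as a subset of V(H).
  copy : Subset (suc m * suc n₂) → Fin (suc m) → Subset n₂
  copy S i = tail (lookup (blocks S) i)

  ∈copy : ∀ {S i h} → leaf i h ∈ S → h ∈ copy S i
  ∈copy {S} {i} {h} h∈ = ∈-tail⁺ (∈-concat⁻ (blocks S) i (subst (leaf i h ∈_) (concat-blocks S) h∈))

  ∑∣copy∣≤∣S∣ : ∀ S → ∑ (λ i → ∣ copy S i ∣) ≤ ∣ S ∣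
  ∑∣copy∣≤∣S∣ S = begin
    ∑ (λ i → ∣ copy S i ∣)             ≤⟨ ∑-mono (λ i → ∣tail∣≤∣p∣ (lookup (blocks S) i)) ⟩
    ∑ (λ i → ∣ lookup (blocks S) i ∣)  ≡⟨ ∣concat∣ (blocks S) ⟨
    ∣ concat (blocks S) ∣              ≡⟨ cong ∣_∣ (concat-blocks S) ⟨
    ∣ S ∣                              ∎
    where open ≤-Reasoning

  resolver-in-copy : ∀ S {i a b w} → a ≢ b → w ∈ S → InInterval X (leaf i a) w (leaf i b) →
                     ∃ λ c → c ∈ copy S i × (c ≡ b ⊎ Between H a b c)
  resolver-in-copy S {i} {b = b} {w} a≢b w∈S b∈ with w ≟ leaf i b
  ... | yes refl = b , ∈copy {S} {i} w∈S , inj₁ refl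
  ... | no w≢b with interval-within-copy {i = i} a≢b b∈ w≢b
  ...   | c , refl , btw = c , ∈copy {S} {i} w∈S , inj₂ btw

  module _ {S} (S-res : IsStrongResolvingSet X S) where

    copy-resolves : ∀ i → IsLocalResolvingSet H (copy S i)
    copy-resolves i a b a≢b with S-res (leaf i a) (leaf i b) (a≢b ∘ leaf-injective {i} {i})
    ... | w , w∈S , inj₁ b∈ with resolver-in-copy S {i} a≢b w∈S b∈
    ...   | c , c∈ , c≡b⊎btw = c , c∈ , [ is-right , via-right ]′ c≡b⊎btw
    copy-resolves i a b a≢b | w , w∈S , inj₂ a∈ with resolver-in-copy S {i} (a≢b ∘ sym) w∈S a∈
    ...   | c , c∈ , c≡a⊎btw = c , c∈ , [ is-left , via-left ]′ c≡a⊎btw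

    two-copies : ∀ {i j} → i ≢ j → ∀ a b → leaf i a ∈ S ⊎ leaf j b ∈ S
    two-copies {i} {j} i≢j a b with S-res (leaf i a) (leaf j b) (i≢j ∘ combine-injectiveˡ i (suc a) j (suc b))
    ... | w , w∈S , inj₁ b∈ = inj₂ (subst (_∈ S) (interval-across-copies i≢j b∈) w∈S)
    ... | w , w∈S , inj₂ a∈ = inj₁ (subst (_∈ S) (interval-across-copies (i≢j ∘ sym) a∈) w∈S)

  ∣S∣≥-except : ∀ {d} S i₀ → (∀ j → j ≢ i₀ → ∣ copy S j ∣ ≡ n₂) → d ≤ ∣ copy S i₀ ∣ →
                m * n₂ + d ≤ ∣ S ∣
  ∣S∣≥-except S i₀ full-except d≤ =
    ≤-trans (∑-≥-except (λ i → ∣ copy S i ∣) i₀ (λ j j≢i₀ → ≤-reflexive (sym (full-except j j≢i₀))) d≤)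
            (∑∣copy∣≤∣S∣ S)

  -- All copies but at most one lie entirely in S, and the remaining one is a local resolving set of H.
  lower-bound : ∀ {d} → (∀ R → IsLocalResolvingSet H R → d ≤ ∣ R ∣) → d ≤ n₂ →
                ∀ S → IsStrongResolvingSet X S → m * n₂ + d ≤ ∣ S ∣
  lower-bound {d} d-min d≤n₂ S S-res with any? (λ i → any? (λ h → ¬? (h ∈? copy S i)))
  ... | yes (i₀ , h , h∉) = ∣S∣≥-except S i₀ full-except (d-min _ (copy-resolves S-res i₀))
    where
    full-except : ∀ j → j ≢ i₀ → ∣ copy S j ∣ ≡ n₂
    full-except j j≢i₀ = full⇒∣p∣≡n _ λ b →
      [ ⊥-elim ∘ h∉ ∘ ∈copy {S} {i₀} , ∈copy {S} {j} ]′ (two-copies S-res (j≢i₀ ∘ sym) h b)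
  ... | no ¬missing = ∣S∣≥-except S zero (λ j _ → full j) (subst (d ≤_) (sym (full zero)) d≤n₂)
    where
    full : ∀ i → ∣ copy S i ∣ ≡ n₂
    full i = full⇒∣p∣≡n _ λ h → decidable-stable (h ∈? copy S i) λ h∉ → ¬missing (i , h , h∉)

  upperBlock : Subset n₂ → Fin (suc m) → Subset (suc n₂)
  upperBlock R zero    = false ∷ R
  upperBlock R (suc i) = false ∷ ⊤

  upperSet : Subset n₂ → Subset (suc m * suc n₂)
  upperSet R = concat (tabulate (upperBlock R))

  ∣upperSet∣ : ∀ R → ∣ upperSet R ∣ ≡ m * n₂ + ∣ R ∣
  ∣upperSet∣ R = begin
    ∣ upperSet R ∣
      ≡⟨ ∣concat∣ (tabulate (upperBlock R)) ⟩
    ∑ (λ i → ∣ lookup (tabulate (upperBlock R)) i ∣)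
      ≡⟨ sum-cong-≗ (λ i → cong ∣_∣ (lookup∘tabulate (upperBlock R) i)) ⟩
    ∣ R ∣ + ∑ {m} (λ _ → ∣ ⊤ {n₂} ∣)
      ≡⟨ cong (∣ R ∣ +_) (trans (sum-cong-≗ {m} (λ _ → ∣⊤∣≡n n₂)) (∑-const m n₂)) ⟩
    ∣ R ∣ + m * n₂
      ≡⟨ +-comm ∣ R ∣ (m * n₂) ⟩
    m * n₂ + ∣ R ∣
      ∎
    where open ≡-Reasoning

  leaf∈upperSet : ∀ {R i h} → suc h ∈ upperBlock R i → leaf i h ∈ upperSet R
  leaf∈upperSet {R} {i} {h} h∈ =
    ∈-concat⁺ (tabulate (upperBlock R)) i (subst (suc h ∈_) (sym (lookup∘tabulate (upperBlock R) i)) h∈)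

  module _ (G-conn : Connected G) (h₀ : Fin n₂) (spare : NoUniversal H ⊎ 2 ≤ suc m)
           {R : Subset n₂} (R-res : IsLocalResolvingSet H R) where

    private
      S : Subset (suc m * suc n₂)
      S = upperSet R

      walk : Connected X
      walk = connected G-conn

      full-copy : ∀ i h → leaf (suc i) h ∈ S
      full-copy i h = leaf∈upperSet {R} {suc i} (there ∈⊤)

      R-copy : ∀ {h} → h ∈ R → leaf zero h ∈ S
      R-copy h∈ = leaf∈upperSet {R} {zero} (there h∈)

      Resolved : Fin (suc m * suc n₂) → Fin (suc m * suc n₂) → Set
      Resolved x y = ∃ λ w → w ∈ S × StronglyResolves X w x y

      -- The one pair that needs a second copy of H or a vertex of R far from b.
      root₀-leaf₀ : NoUniversal H ⊎ 2 ≤ suc m → ∀ b → Resolved (root zero) (leaf zero b)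
      root₀-leaf₀ (inj₂ (s≤s 1≤m)) b with geodesic-via-roots G-conn {i = suc (fromℕ< 1≤m)} {j = zero} (λ ()) b h₀
      ... | W , W-short , _ , root₀∈W = leaf (suc (fromℕ< 1≤m)) h₀ , full-copy _ h₀ ,
                                        inj₂ (W , W-short , root₀∈W)
      root₀-leaf₀ (inj₁ no-univ) b with local-resolver-nonNeighbour R-res (proj₂ (no-univ b))
      ... | c , c∈R , inj₁ refl        = leaf zero c , R-copy c∈R ,
                                         local⇒resolves (is-right refl) (walk (root zero) (leaf zero c))
      ... | c , c∈R , inj₂ (c≢b , ¬bc) = leaf zero c , R-copy c∈R ,
        inj₂ (between⇒interval (leaf-root-adj {zero} {b} , root-leaf-adj {zero} {c} ,
                                ¬bc ∘ subst T (adj-leaves zero b c) , c≢b ∘ sym ∘ leaf-injective {zero} {zero}))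

      root-leaf₀ : ∀ i b → Resolved (root i) (leaf zero b)
      root-leaf₀ zero    b = root₀-leaf₀ spare b
      root-leaf₀ (suc i) b with geodesic-via-roots G-conn {i = suc i} {j = zero} (λ ()) b h₀
      ... | W , W-short , rootᵢ∈W , _ = leaf (suc i) h₀ , full-copy i h₀ , inj₂ (W , W-short , rootᵢ∈W)

      roots : ∀ i j → i ≢ j → Resolved (root i) (root j)
      roots zero    zero    i≢j = ⊥-elim (i≢j refl)
      roots zero    (suc j) _   = leaf (suc j) h₀ , full-copy j h₀ , inj₁ (root-on-geodesic G-conn zero (suc j) h₀)
      roots (suc i) j       _   = leaf (suc i) h₀ , full-copy i h₀ , inj₂ (root-on-geodesic G-conn j (suc i) h₀)

      leaves₀ : ∀ a b → a ≢ b → Resolved (leaf zero a) (leaf zero b)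
      leaves₀ a b a≢b with R-res a b a≢b
      ... | c , c∈R , lr = leaf zero c , R-copy c∈R ,
                           local⇒resolves (local-leaves⁺ {zero} lr) (via-root zero a b)

      resolve : ∀ (i : Fin (suc m)) t j (s : Fin (suc n₂)) → combine i t ≢ combine j s →
                Resolved (combine i t) (combine j s)
      resolve (suc i) (suc a) j       s       _  =
        leaf (suc i) a , full-copy i a , local⇒resolves (is-left refl) (walk (leaf (suc i) a) (combine j s))
      resolve i       t       (suc j) (suc b) _  =
        leaf (suc j) b , full-copy j b , local⇒resolves (is-right refl) (walk (combine i t) (leaf (suc j) b))
      resolve i       zero    j       zero    ne = roots i j (ne ∘ cong root)
      resolve i       zero    zero    (suc b) _  = root-leaf₀ i b
      resolve zero    (suc a) j       zero    _  with root-leaf₀ j a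
      ... | w , w∈S , r = w , w∈S , resolves-sym r
      resolve zero    (suc a) zero    (suc b) ne = leaves₀ a b (ne ∘ cong (leaf zero))

    upperSet-resolving : IsStrongResolvingSet X (upperSet R)
    upperSet-resolving = resolving-by-positions S resolve

  corona-dimension : Connected G → Fin n₂ → NoUniversal H ⊎ 2 ≤ suc m → ∀ d → IsLocalMetricDim H d →
                     IsStrongMetricDim X (m * n₂ + d)
  corona-dimension G-conn h₀ spare d ((R , R-res , ∣R∣≡d) , d-min) =
    (upperSet R , upperSet-resolving G-conn h₀ spare R-res , trans (∣upperSet∣ R) (cong (m * n₂ +_) ∣R∣≡d)) ,
    lower-bound d-min (subst (_≤ n₂) ∣R∣≡d (∣p∣≤n R))

-- The join K₁ + H

module Join {n : ℕ} (H : Graph n) where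

  K : Graph (suc n)
  K = K1+ H

  join-diameter≤2 : DiameterAtMostTwo K
  join-diameter≤2 zero    zero    = [] , z≤n
  join-diameter≤2 zero    (suc b) = (tt ∷ []) , s≤s z≤n
  join-diameter≤2 (suc a) zero    = (tt ∷ []) , s≤s z≤n
  join-diameter≤2 (suc a) (suc b) = (_∷_ {v = zero} tt (tt ∷ [])) , s≤s (s≤s z≤n)

  local⁺ : ∀ {c a b} → LocallyResolves H c a b → LocallyResolves K (suc c) (suc a) (suc b)
  local⁺ (is-left refl)                    = is-left refl
  local⁺ (is-right refl)                   = is-right refl
  local⁺ (via-right (ab , bc , ¬ac , a≢c)) = via-right (ab , bc , ¬ac , a≢c ∘ suc-injective)
  local⁺ (via-left (ba , ac , ¬bc , b≢c))  = via-left (ba , ac , ¬bc , b≢c ∘ suc-injective)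

  -- The apex is adjacent to everything, so it is never the far end of an induced path.
  local⁻ : ∀ {w a b} → LocallyResolves K w (suc a) (suc b) → ∃ λ c → w ≡ suc c × LocallyResolves H c a b
  local⁻ {zero}  (via-right (_ , _ , ¬a0 , _))        = ⊥-elim (¬a0 tt)
  local⁻ {zero}  (via-left (_ , _ , ¬b0 , _))         = ⊥-elim (¬b0 tt)
  local⁻ {suc c} (is-left refl)                       = c , refl , is-left refl
  local⁻ {suc c} (is-right refl)                      = c , refl , is-right refl
  local⁻ {suc c} (via-right (ab , bc , ¬ac , a≢c))    = c , refl , via-right (ab , bc , ¬ac , a≢c ∘ cong suc)
  local⁻ {suc c} (via-left (ba , ac , ¬bc , b≢c))     = c , refl , via-left (ba , ac , ¬bc , b≢c ∘ cong suc)

  ApexResolved : Subset (suc n) → Set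
  ApexResolved S = ∀ b → ∃ λ w → w ∈ S × LocallyResolves K w zero (suc b)

  restrict : ∀ {x R} → IsLocalResolvingSet K (x ∷ R) → IsLocalResolvingSet H R
  restrict res a b a≢b with res (suc a) (suc b) (a≢b ∘ suc-injective)
  ... | w , w∈ , lr with local⁻ lr
  ...   | c , refl , lr′ with w∈
  ...     | there c∈ = c , c∈ , lr′

  extend : ∀ {x R} → IsLocalResolvingSet H R → ApexResolved (x ∷ R) → IsLocalResolvingSet K (x ∷ R)
  extend res apex zero    zero    0≢0 = ⊥-elim (0≢0 refl)
  extend res apex zero    (suc b) _   = apex b
  extend res apex (suc a) zero    _   with apex a
  ... | w , w∈ , lr = w , w∈ , local-sym lr
  extend res apex (suc a) (suc b) a≢b with res a b (a≢b ∘ cong suc)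
  ... | c , c∈ , lr = suc c , there c∈ , local⁺ lr

  apex-resolved : NoUniversal H → ∀ {x R} → IsLocalResolvingSet H R → ApexResolved (x ∷ R)
  apex-resolved no-univ res b with local-resolver-nonNeighbour res (proj₂ (no-univ b))
  ... | c , c∈ , inj₁ refl        = suc c , there c∈ , is-right refl
  ... | c , c∈ , inj₂ (c≢b , ¬bc) = suc c , there c∈ , via-left (tt , tt , ¬bc , c≢b ∘ sym ∘ suc-injective)

  noUniversal⇒localDim : NoUniversal H → ∀ {d} → IsLocalMetricDim K d → IsLocalMetricDim H d
  noUniversal⇒localDim no-univ {d} ((x ∷ R , res , ∣S∣≡d) , d-min) = (R , restrict res , ∣R∣≡d) , d-min′
    where
    d-min′ : ∀ R′ → IsLocalResolvingSet H R′ → d ≤ ∣ R′ ∣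
    d-min′ R′ res′ = d-min (false ∷ R′) (extend res′ (apex-resolved no-univ res′))
    ∣R∣≡d : ∣ R ∣ ≡ d
    ∣R∣≡d = ≤-antisym (≤-trans (∣p∣≤∣x∷p∣ x R) (≤-reflexive ∣S∣≡d)) (d-min′ R (restrict res))

  module _ {u} (univ : Universal H u) where

    universal∈ : ∀ {R} → IsLocalResolvingSet K (false ∷ R) → ∀ {k} → Universal H k → k ∈ R
    universal∈ res {k} univ-k with res zero (suc k) (λ ())
    ... | suc c , there c∈ , is-right refl                       = c∈
    ... | suc c , _        , via-right (_ , _ , ¬0c , _)         = ⊥-elim (¬0c tt)
    ... | suc c , _        , via-left (_ , _ , ¬kc , k≢c)        = ⊥-elim (¬kc (univ-k c (k≢c ∘ cong suc ∘ sym)))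
    ... | zero  , _        , via-right (_ , _ , _ , 0≢0)         = ⊥-elim (0≢0 refl)
    ... | zero  , _        , via-left (_ , _ , ¬k0 , _)          = ⊥-elim (¬k0 tt)

    -- u and the apex are twins, so u can be traded for the apex.
    resolve-with-u : ∀ {R} → IsLocalResolvingSet K (false ∷ R) → ∀ b → b ≢ u →
                     ∃ λ c → c ∈ R - u × LocallyResolves H c u b
    resolve-with-u res b b≢u with universal⊎nonNeighbour H b
    ... | inj₁ univ-b = b , x∈p∧x≢y⇒x∈p-y (universal∈ res univ-b) b≢u , is-right refl
    ... | inj₂ (_ , non) with local-resolver-nonNeighbour (restrict res) non
    ...   | c , c∈ , inj₁ refl        = c , x∈p∧x≢y⇒x∈p-y c∈ b≢u , is-right refl
    ...   | c , c∈ , inj₂ (c≢b , ¬bc) = c , x∈p∧x≢y⇒x∈p-y c∈ c≢u ,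
              via-left (adj-universal H univ b b≢u , univ c c≢u , ¬bc , c≢b ∘ sym)
      where
      c≢u : c ≢ u
      c≢u refl = ¬bc (adj-universal H univ b b≢u)

    remove-universal : ∀ {R} → IsLocalResolvingSet K (false ∷ R) → IsLocalResolvingSet H (R - u)
    remove-universal {R} res a b a≢b with restrict res a b a≢b
    ... | c , c∈ , lr with c ≟ u
    ...   | no c≢u = c , x∈p∧x≢y⇒x∈p-y c∈ c≢u , lr
    remove-universal res a b a≢b | _ , _ , is-left refl  | yes refl = resolve-with-u res b (a≢b ∘ sym)
    remove-universal res a b a≢b | _ , _ , is-right refl | yes refl with resolve-with-u res a a≢b
    ... | c , c∈ , lr = c , c∈ , local-sym lr
    remove-universal res a b a≢b | _ , _ , via-right (_ , _ , ¬au , a≢u) | yes refl =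
      ⊥-elim (¬au (adj-universal H univ a a≢u))
    remove-universal res a b a≢b | _ , _ , via-left (_ , _ , ¬bu , b≢u)  | yes refl =
      ⊥-elim (¬bu (adj-universal H univ b b≢u))

    universal⇒localDim : ∀ {d} → IsLocalMetricDim H d → IsLocalMetricDim K (suc d)
    universal⇒localDim {d} ((R , res , ∣R∣≡d) , d-min) =
      (true ∷ R , extend res (λ b → zero , here , is-left refl) , cong suc ∣R∣≡d) , lower
      where
      lower : ∀ S → IsLocalResolvingSet K S → suc d ≤ ∣ S ∣
      lower (true ∷ R′)  res′ = s≤s (d-min R′ (restrict res′))
      lower (false ∷ R′) res′ =
        ≤-trans (s≤s (d-min (R′ - u) (remove-universal res′))) (x∈p⇒∣p-x∣<∣p∣ (universal∈ res′ univ))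

hasDiameter⇒diameter≤ : ∀ {n} {H : Graph n} {d} → HasDiameter H d → ∀ u v → Walk≤ H d u v
hasDiameter⇒diameter≤ (H-conn , bounded , _) u v with shortestʷ (H-conn u v)
... | p , p-short = p , bounded u v p p-short

-- A universal vertex has degree n − 1 > Δ unless n = 1, and the one-vertex graph has diameter 0, not 2.
maxDegree≤n-2⇒noUniversal : ∀ {n} (H : Graph (suc n)) → HasDiameter H 2 → maxDegree H ≤ suc n ∸ 2 →
                            NoUniversal H
maxDegree≤n-2⇒noUniversal {zero} H (_ , _ , zero , zero , p , p-short , len≡2) _ =
  ⊥-elim (≤⇒≯ (p-short []) (subst (0 <_) (sym len≡2) (s≤s z≤n)))
maxDegree≤n-2⇒noUniversal {suc k} H _ Δ≤ u with universal⊎nonNeighbour H u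
... | inj₂ non  = non
... | inj₁ univ = ⊥-elim (<-irrefl refl (≤-trans (≤-reflexive (sym (universal⇒degree≡n-1 H univ)))
                                                 (≤-trans (degree≤maxDegree H u) Δ≤)))

farFrom⇒noUniversal : ∀ {n} (H : Graph n) → ¬ Connected H ⊎ DiameterGreaterThanTwo H → NoUniversal H
farFrom⇒noUniversal H far u with universal⊎nonNeighbour H u | far
... | inj₂ non  | _ = non
... | inj₁ univ | inj₁ disconnected = ⊥-elim (disconnected λ a b → proj₁ (universal⇒diameter≤2 H univ a b))
... | inj₁ univ | inj₂ (_ , a , b , p , p-short , 2<len) with universal⇒diameter≤2 H univ a b
...   | q , q≤2 = ⊥-elim (≤⇒≯ (≤-trans (p-short q) q≤2) 2<len)

theorem10 : ∀ {n₁ n₂ : ℕ} (G : Graph n₁) (H : Graph n₂) →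
  1 ≤ n₁ → 1 ≤ n₂ → Connected G →
  -- (i)
  ((maxDegree H ≡ n₂ ∸ 1) →
    ∀ d → IsStrongMetricDim H d → IsStrongMetricDim (K1+ H) (suc d))
  -- (ii)
  × (HasDiameter H 2 → (maxDegree H ≤ n₂ ∸ 2 ⊎ 2 ≤ n₁) →
    ∀ d → IsStrongMetricDim H d →
      IsStrongMetricDim (corona G H) ((n₁ ∸ 1) * n₂ + d))
  -- (iii)
  × ((¬ Connected H ⊎ DiameterGreaterThanTwo H) →
    ∀ d → IsStrongMetricDim (K1+ H) d →
      IsStrongMetricDim (corona G H) ((n₁ ∸ 1) * n₂ + d))
theorem10 {suc m} {suc n} G H _ _ G-conn = part-i , part-ii , part-iii
  where
  open Join H using (join-diameter≤2; universal⇒localDim; noUniversal⇒localDim)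
  open CoronaDimension G H using (corona-dimension)

  part-i : maxDegree H ≡ n → ∀ d → IsStrongMetricDim H d → IsStrongMetricDim (K1+ H) (suc d)
  part-i Δ≡n d dim with maxDegree≡n-1⇒universal H Δ≡n
  ... | u , univ = localDim⇒strongDim join-diameter≤2
                     (universal⇒localDim univ (strongDim⇒localDim (universal⇒diameter≤2 H univ) dim))

  part-ii : HasDiameter H 2 → maxDegree H ≤ suc n ∸ 2 ⊎ 2 ≤ suc m →
            ∀ d → IsStrongMetricDim H d → IsStrongMetricDim (corona G H) (m * suc n + d)
  part-ii diam spare d dim =
    corona-dimension G-conn zero (Sum.map₁ (maxDegree≤n-2⇒noUniversal H diam) spare) d
      (strongDim⇒localDim (hasDiameter⇒diameter≤ diam) dim)

  part-iii : ¬ Connected H ⊎ DiameterGreaterThanTwo H →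
             ∀ d → IsStrongMetricDim (K1+ H) d → IsStrongMetricDim (corona G H) (m * suc n + d)
  part-iii far d dim =
    corona-dimension G-conn zero (inj₁ no-univ) d
      (noUniversal⇒localDim no-univ (strongDim⇒localDim join-diameter≤2 dim))
    where
    no-univ : NoUniversal H
    no-univ = farFrom⇒noUniversal H far
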